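{- Let $N$ be a positive odd integer and $r\ge s\ge 2$. Then the Atkin operator $U$ and the nebentypus action of $\Gamma=1+4\mathbb{Z}_2$ commute on $\Phi_r^{s\,\mathrm{ab}}$, where $\Phi_r^s=\Gamma_1(2^sN)\cap\Gamma_0(2^r)$.
   Context: $\Gamma_1(M)$: matrices in $\mathrm{SL}_2(\mathbb{Z})$ congruent to $\begin{pmatrix}1&*\\0&1\end{pmatrix}$ mod $M$; $\Gamma_0(M)$: lower-left entry divisible by $M$; $\Gamma^0(2)$: matrices in $\mathrm{SL}_2(\mathbb{Z})$ with even upper-right entry; $t=\begin{pmatrix}1&0\\0&2\end{pmatrix}$; $\Gamma_r=1+2^r\mathbb{Z}_2$. Atkin operator $U$ on $\Phi_r^{s\,\mathrm{ab}}$: composition of the transfer $\Phi_r^{s\,\mathrm{ab}}\to(\Phi_r^s\cap\Gamma^0(2))^{\mathrm{ab}}$, the isomorphism onto $\Phi_{r+1}^{s\,\mathrm{ab}}$ induced by $g\mapsto tgt^{ -1}$, and the map $\Phi_{r+1}^{s\,\mathrm{ab}}\to\Phi_r^{s\,\mathrm{ab}}$ induced by inclusion. Nebentypus action: for $d\in\Gamma$, choose $\alpha=\begin{pmatrix}a&b\\c&d'\end{pmatrix}\in\Gamma_1(4N)\cap\Gamma_0(2^{r+1})\cap\Gamma^0(2)$ with $d'\equiv d\bmod 2^r$ (such $\alpha$ exists); $d$ acts on $\Phi_r^{s\,\mathrm{ab}}$ by $x\mapsto\alpha x\alpha^{ -1}$, which is independent of the choice of $\alpha$. -}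

module Defs where

open import Data.Nat as ℕ using (ℕ; zero; suc)
open import Data.Integer using (ℤ; +_; -_; _+_; _-_; _*_; _/_; _%_)
open import Data.Integer.Divisibility using (_∣_)
open import Data.Product using (_×_)
open import Relation.Binary.PropositionalEquality using (_≡_)

record Mat : Set where
  constructor mat
  field
    a b c d : ℤ
open Mat public

infixl 7 _·_
_·_ : Mat → Mat → Mat
mat a₁ b₁ c₁ d₁ · mat a₂ b₂ c₂ d₂ =
  mat (a₁ * a₂ + b₁ * c₂) (a₁ * b₂ + b₁ * d₂) (c₁ * a₂ + d₁ * c₂) (c₁ * b₂ + d₁ * d₂)

-- inverse of a determinant-one matrix
inv : Mat → Mat
inv (mat a b c d) = mat d (- b) (- c) a

I₂ : Mat
I₂ = mat (+ 1) (+ 0) (+ 0) (+ 1)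

infix 4 _≡[_]_
_≡[_]_ : ℤ → ℕ → ℤ → Set
x ≡[ M ] y = (+ M) ∣ (x - y)

SL₂ : Mat → Set
SL₂ g = a g * d g - b g * c g ≡ + 1

Γ₁ : ℕ → Mat → Set
Γ₁ M g = SL₂ g × (a g ≡[ M ] + 1) × ((+ M) ∣ c g) × (d g ≡[ M ] + 1)

Γ₀ : ℕ → Mat → Set
Γ₀ M g = SL₂ g × ((+ M) ∣ c g)

Γ⁰₂ : Mat → Set
Γ⁰₂ g = SL₂ g × ((+ 2) ∣ b g)

Φ : ℕ → ℕ → ℕ → Mat → Set
Φ N r s g = Γ₁ (2 ℕ.^ s ℕ.* N) g × Γ₀ (2 ℕ.^ r) g

comm : Mat → Mat → Mat
comm g h = g · h · inv g · inv h

-- The commutator subgroup [H,H] of the subgroup H (given as a predicate):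
-- finite products of commutators of elements of H (closed under inverses
-- since [g,h]⁻¹ = [h,g]).
data Comm (H : Mat → Set) : Mat → Set where
  one  : Comm H I₂
  step : ∀ {g h x} → H g → H h → Comm H x → Comm H (comm g h · x)

-- equality of the classes of x and y in H^ab (x, y ∈ H)
AbEq : (Mat → Set) → Mat → Mat → Set
AbEq H x y = Comm H (x · inv y)

-- T = (1 1 ; 0 1) ∈ Φ_r^s \ Γ⁰(2); {1, T} is a right transversal of
-- Φ_r^s ∩ Γ⁰(2) in Φ_r^s (index 2).
T : Mat
T = mat (+ 1) (+ 1) (+ 0) (+ 1)

-- Transfer Φ_r^s → (Φ_r^s ∩ Γ⁰(2)) on representatives, w.r.t. transversal {1,T}:
--   g ∈ Γ⁰(2): V(g) = g · (T g T⁻¹);   g ∉ Γ⁰(2): V(g) = (g T⁻¹)(T g) = g g.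
transferAux : ℕ → Mat → Mat
transferAux zero    g = g · (T · g · inv T)
transferAux (suc _) g = g · g

transfer : Mat → Mat
transfer g = transferAux (b g % + 2) g

-- conjugation by t = diag(1,2): (a b ; c d) ↦ (a  b/2 ; 2c  d)  (b even)
tconj : Mat → Mat
tconj (mat a b c d) = mat a (b / + 2) (+ 2 * c) d

-- Atkin operator U on representatives of Φ_r^{s ab}
-- (the final inclusion Φ_{r+1}^s ⊆ Φ_r^s is the identity on matrices)
U : Mat → Mat
U g = tconj (transfer g)

neb : Mat → Mat → Mat
neb α x = α · x · inv α

module Submission where

-- Write β = t α t⁻¹. Since α ≡ 1 (mod 2), conjugation by α preserves the parity of the
-- upper-right entry, so it respects the case split of the transfer, and conjugation by t is a
-- homomorphism on matrices with even upper-right entry. Hence U (α x α⁻¹) = β U(x) β⁻¹ if b x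
-- is odd, and U (α x α⁻¹) = (β X β⁻¹) (γ Y γ⁻¹) if b x is even, where X = t x t⁻¹,
-- Y = t (T x T⁻¹) t⁻¹ and γ = t (T α T⁻¹) t⁻¹, while α U(x) α⁻¹ = (α X α⁻¹) (α Y α⁻¹).
-- Now β and γ lie in Γ₀(2^s N) and have the same diagonal as α modulo 2^s N, so β α⁻¹ and
-- γ α⁻¹ lie in Φ_r^s. Each factor on the left is therefore the corresponding factor on the
-- right conjugated by an element of Φ_r^s, which is invisible in the abelianisation.

open import Defs

module OddDivisors where
  open import Data.Nat
  open import Data.Nat.Properties
  open import Data.Nat.Divisibility
  open import Data.Nat.Coprimality using (Coprime; coprime-divisor)
  open import Data.Product using (_,_)
  open import Data.Empty using (⊥-elim)
  open import Relation.Nullary using (¬_)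
  open import Relation.Binary.PropositionalEquality
  open ≡-Reasoning

  ^-monoʳ-∣ : ∀ m {s t} → s ≤ t → m ^ s ∣ m ^ t
  ^-monoʳ-∣ m {s} {t} s≤t = divides (m ^ (t ∸ s)) (begin
    m ^ t               ≡⟨ cong (m ^_) (m+[n∸m]≡n s≤t) ⟨
    m ^ (s + (t ∸ s))   ≡⟨ ^-distribˡ-+-* m s (t ∸ s) ⟩
    m ^ s * m ^ (t ∸ s) ≡⟨ *-comm (m ^ s) _ ⟩
    m ^ (t ∸ s) * m ^ s ∎)

  odd⇒coprime[2] : ∀ {n} → ¬ 2 ∣ n → Coprime n 2
  odd⇒coprime[2] _   {0}               (_ , 0∣2) with () ← 0∣⇒≡0 0∣2
  odd⇒coprime[2] _   {1}               _         = refl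
  odd⇒coprime[2] 2∤n {2}               (2∣n , _) = ⊥-elim (2∤n 2∣n)
  odd⇒coprime[2] _   {suc (suc (suc _))} (_ , i∣2) with s≤s (s≤s ()) ← ∣⇒≤ i∣2

  odd∣2^k*⇒∣ : ∀ {n} k {m} → ¬ 2 ∣ n → n ∣ 2 ^ k * m → n ∣ m
  odd∣2^k*⇒∣ zero {m} _ n∣m = subst (_ ∣_) (*-identityˡ m) n∣m
  odd∣2^k*⇒∣ {n} (suc k) {m} 2∤n n∣2^[1+k]*m =
    odd∣2^k*⇒∣ k 2∤n (coprime-divisor (odd⇒coprime[2] 2∤n) (subst (n ∣_) (*-assoc 2 (2 ^ k) m) n∣2^[1+k]*m))

  2^s*odd∣ : ∀ {n m s t} → ¬ 2 ∣ n → s ≤ t → n ∣ m → 2 ^ t ∣ m → 2 ^ s * n ∣ m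
  2^s*odd∣ {n} {s = s} {t} 2∤n s≤t n∣m (divides q refl) =
    subst (2 ^ s * n ∣_) (*-comm (2 ^ t) q)
      (*-pres-∣ (^-monoʳ-∣ 2 s≤t) (odd∣2^k*⇒∣ t 2∤n (subst (n ∣_) (*-comm q (2 ^ t)) n∣m)))

module Congruences where
  open import Data.Nat using (ℕ)
  open import Data.Integer using (ℤ; +_; -_; _+_; _-_; _*_)
  open import Data.Integer.Properties using (+-identityʳ)
  open import Data.Integer.Divisibility using (_∣_)
  import Data.Integer.Divisibility.Signed as Signed
  open import Data.Integer.Tactic.RingSolver using (solve)
  open import Data.List using (_∷_; [])
  open import Relation.Binary.Bundles using (Setoid)
  open import Relation.Binary.PropositionalEquality

  -- _≡[_]_ wrapped in a record, so that x, y and M can be inferred from a proof.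
  infix 4 _≡_[mod_]
  record _≡_[mod_] (x y : ℤ) (M : ℕ) : Set where
    constructor mod
    field unmod : x ≡[ M ] y
  open _≡_[mod_] public

  private variable
    M : ℕ
    x x′ y y′ z : ℤ

  private
    signed : x ≡ y [mod M ] → Signed._∣_ (+ M) (x - y)
    signed (mod p) = Signed.∣ᵤ⇒∣ p

    unsigned : ∀ {n} x y → Signed._∣_ (+ M) n → n ≡ x - y → x ≡ y [mod M ]
    unsigned _ _ p refl = mod (Signed.∣⇒∣ᵤ p)

  ≡[mod]-refl : x ≡ x [mod M ]
  ≡[mod]-refl {x} = unsigned x x (Signed.divides (+ 0) refl) (solve (x ∷ []))

  ≡[mod]-sym : x ≡ y [mod M ] → y ≡ x [mod M ]
  ≡[mod]-sym {x} {y} p = unsigned y x (Signed.∣m⇒∣-m (signed p)) (solve (x ∷ y ∷ []))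

  ≡[mod]-trans : x ≡ y [mod M ] → y ≡ z [mod M ] → x ≡ z [mod M ]
  ≡[mod]-trans {x} {y} {z = z} p q =
    unsigned x z (Signed.∣m∣n⇒∣m+n (signed p) (signed q)) (solve (x ∷ y ∷ z ∷ []))

  +-cong[mod] : x ≡ x′ [mod M ] → y ≡ y′ [mod M ] → x + y ≡ x′ + y′ [mod M ]
  +-cong[mod] {x} {x′} {y = y} {y′} p q =
    unsigned (x + y) (x′ + y′) (Signed.∣m∣n⇒∣m+n (signed p) (signed q)) (solve (x ∷ x′ ∷ y ∷ y′ ∷ []))

  *-cong[mod] : x ≡ x′ [mod M ] → y ≡ y′ [mod M ] → x * y ≡ x′ * y′ [mod M ]
  *-cong[mod] {x} {x′} {y = y} {y′} p q = unsigned (x * y) (x′ * y′)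
    (Signed.∣m∣n⇒∣m+n (Signed.∣n⇒∣m*n x (signed q)) (Signed.∣m⇒∣m*n y′ (signed p)))
    (solve (x ∷ x′ ∷ y ∷ y′ ∷ []))

  +-congˡ[mod] : ∀ x → y ≡ y′ [mod M ] → x + y ≡ x + y′ [mod M ]
  +-congˡ[mod] x = +-cong[mod] (≡[mod]-refl {x})

  *-congˡ[mod] : ∀ x → y ≡ y′ [mod M ] → x * y ≡ x * y′ [mod M ]
  *-congˡ[mod] x = *-cong[mod] (≡[mod]-refl {x})

  *-congʳ[mod] : ∀ y → x ≡ x′ [mod M ] → x * y ≡ x′ * y [mod M ]
  *-congʳ[mod] y p = *-cong[mod] p (≡[mod]-refl {y})

  -‿cong[mod] : x ≡ y [mod M ] → - x ≡ - y [mod M ]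
  -‿cong[mod] {x} {y} p = unsigned (- x) (- y) (Signed.∣m⇒∣-m (signed p)) (solve (x ∷ y ∷ []))

  ∣⇒≡0[mod] : ∀ x → (+ M) ∣ x → x ≡ + 0 [mod M ]
  ∣⇒≡0[mod] {M} x M∣x = mod (subst ((+ M) ∣_) (sym (+-identityʳ x)) M∣x)

  ≡0[mod]⇒∣ : x ≡ + 0 [mod M ] → (+ M) ∣ x
  ≡0[mod]⇒∣ {x} {M} (mod p) = subst ((+ M) ∣_) (+-identityʳ x) p

  ∣-respʳ-≡[mod] : ∀ x y → x ≡ y [mod M ] → (+ M) ∣ x → (+ M) ∣ y
  ∣-respʳ-≡[mod] x y x≡y M∣x = ≡0[mod]⇒∣ (≡[mod]-trans (≡[mod]-sym x≡y) (∣⇒≡0[mod] x M∣x))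

  ≡[mod]-setoid : ℕ → Setoid _ _
  ≡[mod]-setoid M = record
    { Carrier       = ℤ
    ; _≈_           = _≡_[mod M ]
    ; isEquivalence = record { refl = ≡[mod]-refl ; sym = ≡[mod]-sym ; trans = ≡[mod]-trans }
    }

  module ≡[mod]-Reasoning (M : ℕ) where
    open import Relation.Binary.Reasoning.Setoid (≡[mod]-setoid M) public

module Halving where
  open import Data.Nat as ℕ using (suc; s≤s)
  import Data.Nat.Divisibility as ℕ
  open import Data.Integer using (ℤ; +_; _+_; _-_; _*_; _/_; _%_)
  open import Data.Integer.Properties using (+-identityˡ; *-cancelʳ-≡)
  open import Data.Integer.DivMod using (a≡a%n+[a/n]*n; n%d<d)
  open import Data.Integer.Divisibility using (_∣_)
  import Data.Integer.Divisibility.Signed as Signed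
  open import Data.Integer.Tactic.RingSolver using (solve)
  open import Data.List using (_∷_; [])
  open import Data.Empty using (⊥-elim)
  open import Relation.Nullary using (¬_)
  open import Relation.Binary.PropositionalEquality
  open ≡-Reasoning

  private
    2∤1 : ¬ Signed._∣_ (+ 2) (+ 1)
    2∤1 2∣1 with () ← ℕ.∣1⇒≡1 (Signed.∣⇒∣ᵤ 2∣1)

  [k*2]%2≡0 : ∀ k → (k * + 2) % + 2 ≡ 0
  [k*2]%2≡0 k with (k * + 2) % + 2 | (k * + 2) / + 2 | a≡a%n+[a/n]*n (k * + 2) (+ 2) | n%d<d (k * + 2) (+ 2)
  ... | 0           | _ | _  | _ = refl
  ... | 1           | q | eq | _ = ⊥-elim (2∤1 (Signed.divides (k - q) (begin
    + 1                         ≡⟨ solve (q ∷ []) ⟩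
    + 1 + q * + 2 - q * + 2     ≡⟨ cong (_- q * + 2) eq ⟨
    k * + 2 - q * + 2           ≡⟨ solve (k ∷ q ∷ []) ⟩
    (k - q) * + 2               ∎)))
  ... | suc (suc _) | _ | _  | s≤s (s≤s ())

  [k*2]/2≡k : ∀ k → (k * + 2) / + 2 ≡ k
  [k*2]/2≡k k = *-cancelʳ-≡ _ k (+ 2) (begin
    q * + 2                     ≡⟨ +-identityˡ _ ⟨
    + 0 + q * + 2               ≡⟨ cong (λ r → + r + q * + 2) ([k*2]%2≡0 k) ⟨
    + ((k * + 2) % + 2) + q * + 2 ≡⟨ a≡a%n+[a/n]*n (k * + 2) (+ 2) ⟨
    k * + 2                     ∎)
    where
    q : ℤ
    q = (k * + 2) / + 2

  %2≡0⇒2∣ : ∀ z → z % + 2 ≡ 0 → (+ 2) ∣ z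
  %2≡0⇒2∣ z z%2≡0 = Signed.∣⇒∣ᵤ (Signed.divides (z / + 2) (begin
    z                           ≡⟨ a≡a%n+[a/n]*n z (+ 2) ⟩
    + (z % + 2) + z / + 2 * + 2 ≡⟨ cong (λ r → + r + z / + 2 * + 2) z%2≡0 ⟩
    + 0 + z / + 2 * + 2         ≡⟨ +-identityˡ _ ⟩
    z / + 2 * + 2               ∎))

module Matrices where
  open import Data.Integer using (ℤ; +_; -_; _+_; _-_; _*_)
  open import Data.Integer.Tactic.RingSolver using (solve-∀)
  open import Relation.Binary.PropositionalEquality
  open ≡-Reasoning

  cong-mat : ∀ {p q u v p′ q′ u′ v′} → p ≡ p′ → q ≡ q′ → u ≡ u′ → v ≡ v′ →
             mat p q u v ≡ mat p′ q′ u′ v′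
  cong-mat refl refl refl refl = refl

  ·-assoc : ∀ g h k → g · h · k ≡ g · (h · k)
  ·-assoc (mat p₁ q₁ u₁ v₁) (mat p₂ q₂ u₂ v₂) (mat p₃ q₃ u₃ v₃) =
    cong-mat (entry p₁ q₁ p₂ q₂ u₂ v₂ p₃ u₃) (entry p₁ q₁ p₂ q₂ u₂ v₂ q₃ v₃)
             (entry u₁ v₁ p₂ q₂ u₂ v₂ p₃ u₃) (entry u₁ v₁ p₂ q₂ u₂ v₂ q₃ v₃)
    where
    entry : ∀ x y p q u v z w → (x * p + y * u) * z + (x * q + y * v) * w ≡ x * (p * z + q * w) + y * (u * z + v * w)
    entry = solve-∀

  ·-identityˡ : ∀ g → I₂ · g ≡ g
  ·-identityˡ (mat p q u v) = cong-mat (entry p u) (entry q v) (entry′ p u) (entry′ q v)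
    where
    entry : ∀ x y → + 1 * x + + 0 * y ≡ x
    entry = solve-∀
    entry′ : ∀ x y → + 0 * x + + 1 * y ≡ y
    entry′ = solve-∀

  ·-identityʳ : ∀ g → g · I₂ ≡ g
  ·-identityʳ (mat p q u v) = cong-mat (entry p q) (entry′ p q) (entry u v) (entry′ u v)
    where
    entry : ∀ x y → x * + 1 + y * + 0 ≡ x
    entry = solve-∀
    entry′ : ∀ x y → x * + 0 + y * + 1 ≡ y
    entry′ = solve-∀

  inv-involutive : ∀ g → inv (inv g) ≡ g
  inv-involutive (mat p q u v) = cong-mat refl (entry q) (entry u) refl
    where
    entry : ∀ x → - (- x) ≡ x
    entry = solve-∀

  inv-anti-homo : ∀ g h → inv (g · h) ≡ inv h · inv g
  inv-anti-homo (mat p₁ q₁ u₁ v₁) (mat p₂ q₂ u₂ v₂) =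
    cong-mat (entryᵃ p₁ q₁ u₁ v₁ p₂ q₂ u₂ v₂) (entryᵇ p₁ q₁ u₁ v₁ p₂ q₂ u₂ v₂)
             (entryᶜ p₁ q₁ u₁ v₁ p₂ q₂ u₂ v₂) (entryᵈ p₁ q₁ u₁ v₁ p₂ q₂ u₂ v₂)
    where
    entryᵃ : ∀ p₁ q₁ u₁ v₁ p₂ q₂ u₂ v₂ → u₁ * q₂ + v₁ * v₂ ≡ v₂ * v₁ + (- q₂) * (- u₁)
    entryᵃ = solve-∀
    entryᵇ : ∀ p₁ q₁ u₁ v₁ p₂ q₂ u₂ v₂ → - (p₁ * q₂ + q₁ * v₂) ≡ v₂ * (- q₁) + (- q₂) * p₁
    entryᵇ = solve-∀
    entryᶜ : ∀ p₁ q₁ u₁ v₁ p₂ q₂ u₂ v₂ → - (u₁ * p₂ + v₁ * u₂) ≡ (- u₂) * v₁ + p₂ * (- u₁)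
    entryᶜ = solve-∀
    entryᵈ : ∀ p₁ q₁ u₁ v₁ p₂ q₂ u₂ v₂ → p₁ * p₂ + q₁ * u₂ ≡ (- u₂) * (- q₁) + p₂ * p₁
    entryᵈ = solve-∀

  det : Mat → ℤ
  det g = a g * d g - b g * c g

  det-· : ∀ g h → det (g · h) ≡ det g * det h
  det-· (mat p₁ q₁ u₁ v₁) (mat p₂ q₂ u₂ v₂) = entry p₁ q₁ u₁ v₁ p₂ q₂ u₂ v₂
    where
    entry : ∀ p₁ q₁ u₁ v₁ p₂ q₂ u₂ v₂ →
      (p₁ * p₂ + q₁ * u₂) * (u₁ * q₂ + v₁ * v₂) - (p₁ * q₂ + q₁ * v₂) * (u₁ * p₂ + v₁ * u₂)
        ≡ (p₁ * v₁ - q₁ * u₁) * (p₂ * v₂ - q₂ * u₂)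
    entry = solve-∀

  SL₂-· : ∀ g h → SL₂ g → SL₂ h → SL₂ (g · h)
  SL₂-· g h g∈SL₂ h∈SL₂ = trans (det-· g h) (cong₂ _*_ g∈SL₂ h∈SL₂)

  SL₂-inv : ∀ g → SL₂ g → SL₂ (inv g)
  SL₂-inv (mat p q u v) g∈SL₂ = trans (entry p q u v) g∈SL₂
    where
    entry : ∀ p q u v → v * p - (- q) * (- u) ≡ p * v - q * u
    entry = solve-∀

  ·-inverseʳ : ∀ g → SL₂ g → g · inv g ≡ I₂
  ·-inverseʳ (mat p q u v) g∈SL₂ =
    cong-mat (trans (entry p q u v) g∈SL₂) (entry′ p q) (entry‴ u v) (trans (entry″ p q u v) g∈SL₂)
    where
    entry : ∀ p q u v → p * v + q * (- u) ≡ p * v - q * u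
    entry = solve-∀
    entry′ : ∀ x y → x * (- y) + y * x ≡ + 0
    entry′ = solve-∀
    entry″ : ∀ p q u v → u * (- q) + v * p ≡ p * v - q * u
    entry″ = solve-∀
    entry‴ : ∀ x y → x * y + y * (- x) ≡ + 0
    entry‴ = solve-∀

  ·-inverseˡ : ∀ g → SL₂ g → inv g · g ≡ I₂
  ·-inverseˡ g g∈SL₂ = begin
    inv g · g             ≡⟨ cong (inv g ·_) (inv-involutive g) ⟨
    inv g · inv (inv g)   ≡⟨ ·-inverseʳ (inv g) (SL₂-inv g g∈SL₂) ⟩
    I₂                    ∎

  ·-cancel-middle : ∀ g → SL₂ g → ∀ x y → x · inv g · (g · y) ≡ x · y
  ·-cancel-middle g g∈SL₂ x y = begin
    x · inv g · (g · y)   ≡⟨ ·-assoc x (inv g) (g · y) ⟩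
    x · (inv g · (g · y)) ≡⟨ cong (x ·_) (·-assoc (inv g) g y) ⟨
    x · (inv g · g · y)   ≡⟨ cong (λ e → x · (e · y)) (·-inverseˡ g g∈SL₂) ⟩
    x · (I₂ · y)          ≡⟨ cong (x ·_) (·-identityˡ y) ⟩
    x · y                 ∎

  neb-I₂ : ∀ g → SL₂ g → neb g I₂ ≡ I₂
  neb-I₂ g g∈SL₂ = trans (cong (_· inv g) (·-identityʳ g)) (·-inverseʳ g g∈SL₂)

  neb-by-I₂ : ∀ h → neb I₂ h ≡ h
  neb-by-I₂ h = trans (·-identityʳ (I₂ · h)) (·-identityˡ h)

  neb-· : ∀ g → SL₂ g → ∀ h k → neb g (h · k) ≡ neb g h · neb g k
  neb-· g g∈SL₂ h k = sym (begin
    g · h · inv g · (g · k · inv g)   ≡⟨ cong (g · h · inv g ·_) (·-assoc g k (inv g)) ⟩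
    g · h · inv g · (g · (k · inv g)) ≡⟨ ·-cancel-middle g g∈SL₂ (g · h) (k · inv g) ⟩
    g · h · (k · inv g)               ≡⟨ ·-assoc (g · h) k (inv g) ⟨
    g · h · k · inv g                 ≡⟨ cong (_· inv g) (·-assoc g h k) ⟩
    g · (h · k) · inv g               ∎)

  neb-neb : ∀ g h k → neb (g · h) k ≡ neb g (neb h k)
  neb-neb g h k = begin
    g · h · k · inv (g · h)         ≡⟨ cong (g · h · k ·_) (inv-anti-homo g h) ⟩
    g · h · k · (inv h · inv g)     ≡⟨ ·-assoc (g · h · k) (inv h) (inv g) ⟨
    g · h · k · inv h · inv g       ≡⟨ cong (λ e → e · inv h · inv g) (·-assoc g h k) ⟩
    g · (h · k) · inv h · inv g     ≡⟨ cong (_· inv g) (·-assoc g (h · k) (inv h)) ⟩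
    g · (h · k · inv h) · inv g     ∎

  inv-neb : ∀ g h → inv (neb g h) ≡ neb g (inv h)
  inv-neb g h = begin
    inv (g · h · inv g)         ≡⟨ inv-anti-homo (g · h) (inv g) ⟩
    inv (inv g) · inv (g · h)   ≡⟨ cong₂ _·_ (inv-involutive g) (inv-anti-homo g h) ⟩
    g · (inv h · inv g)         ≡⟨ ·-assoc g (inv h) (inv g) ⟨
    g · inv h · inv g           ∎

  neb-comm : ∀ g → SL₂ g → ∀ h k → neb g (comm h k) ≡ comm (neb g h) (neb g k)
  neb-comm g g∈SL₂ h k = begin
    neb g (h · k · inv h · inv k)
      ≡⟨ neb-· g g∈SL₂ (h · k · inv h) (inv k) ⟩
    neb g (h · k · inv h) · neb g (inv k)
      ≡⟨ cong (_· neb g (inv k)) (neb-· g g∈SL₂ (h · k) (inv h)) ⟩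
    neb g (h · k) · neb g (inv h) · neb g (inv k)
      ≡⟨ cong (λ e → e · neb g (inv h) · neb g (inv k)) (neb-· g g∈SL₂ h k) ⟩
    neb g h · neb g k · neb g (inv h) · neb g (inv k)
      ≡⟨ cong₂ (λ e e′ → neb g h · neb g k · e · e′) (inv-neb g h) (inv-neb g k) ⟨
    comm (neb g h) (neb g k)
      ∎

  neb-shift : ∀ g → SL₂ g → ∀ h k → neb (h · inv g) (neb g k) ≡ neb h k
  neb-shift g g∈SL₂ h k = begin
    neb (h · inv g) (neb g k)   ≡⟨ neb-neb h (inv g) (neb g k) ⟩
    neb h (neb (inv g) (neb g k)) ≡⟨ cong (neb h) (neb-neb (inv g) g k) ⟨
    neb h (neb (inv g · g) k)   ≡⟨ cong (λ e → neb h (neb e k)) (·-inverseˡ g g∈SL₂) ⟩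
    neb h (neb I₂ k)            ≡⟨ cong (neb h) (neb-by-I₂ k) ⟩
    neb h k                     ∎

  neb-distrib-neb : ∀ g → SL₂ g → ∀ h k → neb g (neb h k) ≡ neb (neb g h) (neb g k)
  neb-distrib-neb g g∈SL₂ h k = sym (begin
    neb g h · neb g k · inv (neb g h)    ≡⟨ cong (neb g h · neb g k ·_) (inv-neb g h) ⟩
    neb g h · neb g k · neb g (inv h)    ≡⟨ cong (_· neb g (inv h)) (neb-· g g∈SL₂ h k) ⟨
    neb g (h · k) · neb g (inv h)        ≡⟨ neb-· g g∈SL₂ (h · k) (inv h) ⟨
    neb g (h · k · inv h)                ∎)

module AtkinOperator where
  open import Data.Nat using (zero; suc)
  open import Data.Integer using (+_; -_; _+_; _-_; _*_; _%_)
  open import Data.Integer.Divisibility using (_∣_)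
  import Data.Integer.Divisibility.Signed as Signed
  open import Data.Integer.Tactic.RingSolver using (solve; solve-∀)
  open import Data.List using (_∷_; [])
  open import Data.Empty using (⊥-elim)
  open import Relation.Nullary using (¬_)
  open import Relation.Binary.PropositionalEquality
  open Congruences
  open Halving
  open Matrices

  2∣b-· : ∀ g h → (+ 2) ∣ b g → (+ 2) ∣ b h → (+ 2) ∣ b (g · h)
  2∣b-· (mat p₁ q₁ u₁ v₁) (mat p₂ q₂ u₂ v₂) 2∣q₁ 2∣q₂ = ≡0[mod]⇒∣ (begin
    p₁ * q₂ + q₁ * v₂   ≈⟨ +-cong[mod] (*-congˡ[mod] p₁ (∣⇒≡0[mod] q₂ 2∣q₂))
                                       (*-congʳ[mod] v₂ (∣⇒≡0[mod] q₁ 2∣q₁)) ⟩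
    p₁ * + 0 + + 0 * v₂ ≡⟨ solve (p₁ ∷ v₂ ∷ []) ⟩
    + 0                 ∎)
    where open ≡[mod]-Reasoning 2

  2∣b-inv : ∀ g → (+ 2) ∣ b g → (+ 2) ∣ b (inv g)
  2∣b-inv g 2∣bg = ≡0[mod]⇒∣ (-‿cong[mod] (∣⇒≡0[mod] (b g) 2∣bg))

  2∣b-neb : ∀ g h → (+ 2) ∣ b g → (+ 2) ∣ b h → (+ 2) ∣ b (neb g h)
  2∣b-neb g h 2∣bg 2∣bh = 2∣b-· (g · h) (inv g) (2∣b-· g h 2∣bg 2∣bh) (2∣b-inv g 2∣bg)

  tconj-mat : ∀ p k u v → tconj (mat p (k * + 2) u v) ≡ mat p k (+ 2 * u) v
  tconj-mat p k u v = cong (λ q → mat p q (+ 2 * u) v) ([k*2]/2≡k k)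

  tconj-· : ∀ g h → (+ 2) ∣ b g → (+ 2) ∣ b h → tconj (g · h) ≡ tconj g · tconj h
  tconj-· (mat p₁ q₁ u₁ v₁) (mat p₂ q₂ u₂ v₂) 2∣q₁ 2∣q₂
    with Signed.divides k₁ refl ← Signed.∣ᵤ⇒∣ {+ 2} {q₁} 2∣q₁
       | Signed.divides k₂ refl ← Signed.∣ᵤ⇒∣ {+ 2} {q₂} 2∣q₂ = begin
    tconj (mat p₁ (k₁ * + 2) u₁ v₁ · mat p₂ (k₂ * + 2) u₂ v₂)
      ≡⟨ cong tconj (cong-mat refl (entryᵇ p₁ k₁ v₂ k₂) refl refl) ⟩
    tconj (mat (p₁ * p₂ + k₁ * + 2 * u₂) ((p₁ * k₂ + k₁ * v₂) * + 2)
               (u₁ * p₂ + v₁ * u₂) (u₁ * (k₂ * + 2) + v₁ * v₂))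
      ≡⟨ tconj-mat _ _ _ _ ⟩
    mat (p₁ * p₂ + k₁ * + 2 * u₂) (p₁ * k₂ + k₁ * v₂)
        (+ 2 * (u₁ * p₂ + v₁ * u₂)) (u₁ * (k₂ * + 2) + v₁ * v₂)
      ≡⟨ cong-mat (entryᵃ p₁ p₂ k₁ u₂) refl (entryᶜ u₁ p₂ v₁ u₂) (entryᵈ u₁ k₂ v₁ v₂) ⟩
    mat p₁ k₁ (+ 2 * u₁) v₁ · mat p₂ k₂ (+ 2 * u₂) v₂
      ≡⟨ cong₂ _·_ (tconj-mat p₁ k₁ u₁ v₁) (tconj-mat p₂ k₂ u₂ v₂) ⟨
    tconj (mat p₁ (k₁ * + 2) u₁ v₁) · tconj (mat p₂ (k₂ * + 2) u₂ v₂) ∎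
    where
    open ≡-Reasoning
    entryᵃ : ∀ p₁ p₂ k₁ u₂ → p₁ * p₂ + k₁ * + 2 * u₂ ≡ p₁ * p₂ + k₁ * (+ 2 * u₂)
    entryᵃ = solve-∀
    entryᵇ : ∀ p₁ k₁ v₂ k₂ → p₁ * (k₂ * + 2) + k₁ * + 2 * v₂ ≡ (p₁ * k₂ + k₁ * v₂) * + 2
    entryᵇ = solve-∀
    entryᶜ : ∀ u₁ p₂ v₁ u₂ → + 2 * (u₁ * p₂ + v₁ * u₂) ≡ + 2 * u₁ * p₂ + v₁ * (+ 2 * u₂)
    entryᶜ = solve-∀
    entryᵈ : ∀ u₁ k₂ v₁ v₂ → u₁ * (k₂ * + 2) + v₁ * v₂ ≡ + 2 * u₁ * k₂ + v₁ * v₂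
    entryᵈ = solve-∀

  tconj-inv : ∀ g → (+ 2) ∣ b g → tconj (inv g) ≡ inv (tconj g)
  tconj-inv (mat p q u v) 2∣q with Signed.divides k refl ← Signed.∣ᵤ⇒∣ {+ 2} {q} 2∣q = begin
    tconj (mat v (- (k * + 2)) (- u) p)   ≡⟨ cong (λ e → tconj (mat v e (- u) p)) (entryᵇ k) ⟩
    tconj (mat v ((- k) * + 2) (- u) p)   ≡⟨ tconj-mat v (- k) (- u) p ⟩
    mat v (- k) (+ 2 * (- u)) p           ≡⟨ cong (λ e → mat v (- k) e p) (entryᶜ u) ⟩
    inv (mat p k (+ 2 * u) v)             ≡⟨ cong inv (tconj-mat p k u v) ⟨
    inv (tconj (mat p (k * + 2) u v))     ∎
    where
    open ≡-Reasoning
    entryᵇ : ∀ k → - (k * + 2) ≡ (- k) * + 2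
    entryᵇ = solve-∀
    entryᶜ : ∀ u → + 2 * (- u) ≡ - (+ 2 * u)
    entryᶜ = solve-∀

  tconj-neb : ∀ g h → (+ 2) ∣ b g → (+ 2) ∣ b h → tconj (neb g h) ≡ neb (tconj g) (tconj h)
  tconj-neb g h 2∣bg 2∣bh = begin
    tconj (g · h · inv g)             ≡⟨ tconj-· (g · h) (inv g) (2∣b-· g h 2∣bg 2∣bh) (2∣b-inv g 2∣bg) ⟩
    tconj (g · h) · tconj (inv g)     ≡⟨ cong₂ _·_ (tconj-· g h 2∣bg 2∣bh) (tconj-inv g 2∣bg) ⟩
    tconj g · tconj h · inv (tconj g) ∎
    where open ≡-Reasoning

  SL₂-tconj : ∀ g → (+ 2) ∣ b g → SL₂ g → SL₂ (tconj g)
  SL₂-tconj (mat p q u v) 2∣q g∈SL₂ with Signed.divides k refl ← Signed.∣ᵤ⇒∣ {+ 2} {q} 2∣q =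
    subst SL₂ (sym (tconj-mat p k u v)) (trans (entry p k u v) g∈SL₂)
    where
    entry : ∀ p k u v → p * v - k * (+ 2 * u) ≡ p * v - k * + 2 * u
    entry = solve-∀

  U-odd : ∀ g → ¬ (+ 2) ∣ b g → U g ≡ tconj (g · g)
  U-odd g 2∤bg with b g % + 2 in eq
  ... | zero  = ⊥-elim (2∤bg (%2≡0⇒2∣ (b g) eq))
  ... | suc _ = refl

  U-even : ∀ g → (+ 2) ∣ b g → U g ≡ tconj (g · neb T g)
  U-even g 2∣bg with Signed.divides k eq ← Signed.∣ᵤ⇒∣ {+ 2} {b g} 2∣bg =
    cong (λ r → tconj (transferAux r g)) (trans (cong (_% + 2) eq) ([k*2]%2≡0 k))

module Abelianisation where
  open import Data.Product using (_×_; _,_)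
  open import Relation.Binary.PropositionalEquality
  open ≡-Reasoning
  open Matrices

  record IsSubgroup (H : Mat → Set) : Set where
    field
      ⊆SL₂       : ∀ g → H g → SL₂ g
      ·-closed   : ∀ g h → H g → H h → H (g · h)
      inv-closed : ∀ g → H g → H (inv g)

    neb-closed : ∀ g h → H g → H h → H (neb g h)
    neb-closed g h g∈H h∈H = ·-closed (g · h) (inv g) (·-closed g h g∈H h∈H) (inv-closed g g∈H)

  ∩-subgroup : ∀ {H K} → IsSubgroup H → IsSubgroup K → IsSubgroup (λ g → H g × K g)
  ∩-subgroup H-subgroup K-subgroup = record
    { ⊆SL₂       = λ g (g∈H , _) → H.⊆SL₂ g g∈H
    ; ·-closed   = λ g h (g∈H , g∈K) (h∈H , h∈K) → H.·-closed g h g∈H h∈H , K.·-closed g h g∈K h∈K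
    ; inv-closed = λ g (g∈H , g∈K) → H.inv-closed g g∈H , K.inv-closed g g∈K
    }
    where
    module H = IsSubgroup H-subgroup
    module K = IsSubgroup K-subgroup

  module Commutators {H : Mat → Set} (H-subgroup : IsSubgroup H) where
    open IsSubgroup H-subgroup

    Comm-· : ∀ x y → Comm H x → Comm H y → Comm H (x · y)
    Comm-· _ y one y∈[H,H] = subst (Comm H) (sym (·-identityˡ y)) y∈[H,H]
    Comm-· _ y (step {g} {h} {x} g∈H h∈H x∈[H,H]) y∈[H,H] =
      subst (Comm H) (sym (·-assoc (comm g h) x y)) (step g∈H h∈H (Comm-· x y x∈[H,H] y∈[H,H]))

    Comm-neb : ∀ g x → H g → Comm H x → Comm H (neb g x)
    Comm-neb g _ g∈H one = subst (Comm H) (sym (neb-I₂ g (⊆SL₂ g g∈H))) one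
    Comm-neb g _ g∈H (step {h} {k} {x} h∈H k∈H x∈[H,H]) =
      subst (Comm H) (sym neb-distrib)
        (step (neb-closed g h g∈H h∈H) (neb-closed g k g∈H k∈H) (Comm-neb g x g∈H x∈[H,H]))
      where
      neb-distrib : neb g (comm h k · x) ≡ comm (neb g h) (neb g k) · neb g x
      neb-distrib = trans (neb-· g (⊆SL₂ g g∈H) (comm h k) x) (cong (_· neb g x) (neb-comm g (⊆SL₂ g g∈H) h k))

    AbEq-neb : ∀ g x → H g → H x → AbEq H (neb g x) x
    AbEq-neb g x g∈H x∈H = subst (Comm H) (·-identityʳ (comm g x)) (step g∈H x∈H one)

    AbEq-·-cong : ∀ x x′ y y′ → H x′ → AbEq H x x′ → AbEq H y y′ → AbEq H (x · y) (x′ · y′)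
    AbEq-·-cong x x′ y y′ x′∈H x~x′ y~y′ =
      subst (Comm H) regroup (Comm-· _ _ x~x′ (Comm-neb x′ (y · inv y′) x′∈H y~y′))
      where
      regroup : x · inv x′ · neb x′ (y · inv y′) ≡ x · y · inv (x′ · y′)
      regroup = begin
        x · inv x′ · (x′ · (y · inv y′) · inv x′)
          ≡⟨ cong (x · inv x′ ·_) (·-assoc x′ (y · inv y′) (inv x′)) ⟩
        x · inv x′ · (x′ · (y · inv y′ · inv x′))
          ≡⟨ ·-cancel-middle x′ (⊆SL₂ x′ x′∈H) x (y · inv y′ · inv x′) ⟩
        x · (y · inv y′ · inv x′)                 ≡⟨ cong (x ·_) (·-assoc y (inv y′) (inv x′)) ⟩
        x · (y · (inv y′ · inv x′))               ≡⟨ ·-assoc x y _ ⟨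
        x · y · (inv y′ · inv x′)                 ≡⟨ cong (x · y ·_) (inv-anti-homo x′ y′) ⟨
        x · y · inv (x′ · y′)                     ∎

    AbEq-neb-shift : ∀ g h x → SL₂ g → H (h · inv g) → H (neb g x) → AbEq H (neb h x) (neb g x)
    AbEq-neb-shift g h x g∈SL₂ hg⁻¹∈H gxg⁻¹∈H =
      subst (λ y → AbEq H y (neb g x)) (neb-shift g g∈SL₂ h x) (AbEq-neb (h · inv g) (neb g x) hg⁻¹∈H gxg⁻¹∈H)

module CongruenceSubgroups where
  open import Data.Nat as ℕ using (ℕ)
  import Data.Nat.Divisibility as ℕ
  open import Data.Integer using (+_; -_; _+_; _-_; _*_)
  open import Data.Integer.Properties using (*-identityʳ; *-comm)
  open import Data.Integer.Divisibility using (_∣_)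
  import Data.Integer.Divisibility.Signed as Signed
  open import Data.Integer.Tactic.RingSolver using (solve; solve-∀)
  open import Data.List using (_∷_; [])
  open import Data.Product using (_×_; _,_; proj₁; proj₂)
  open import Relation.Binary.PropositionalEquality using (_≡_; refl)
  open Congruences
  open Matrices
  open AtkinOperator using (SL₂-tconj)
  open Abelianisation using (IsSubgroup; ∩-subgroup)

  private variable
    M K : ℕ

  private
    ∣-neg : ∀ x → (+ M) ∣ x → (+ M) ∣ - x
    ∣-neg x M∣x = ≡0[mod]⇒∣ (-‿cong[mod] (∣⇒≡0[mod] x M∣x))

    ∣-2* : ∀ x → (+ M) ∣ x → (+ M) ∣ + 2 * x
    ∣-2* x M∣x = ≡0[mod]⇒∣ (*-congˡ[mod] (+ 2) (∣⇒≡0[mod] x M∣x))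

  c-· : ∀ g h → (+ M) ∣ c g → (+ M) ∣ c h → (+ M) ∣ c (g · h)
  c-· {M} (mat p₁ q₁ u₁ v₁) (mat p₂ q₂ u₂ v₂) M∣u₁ M∣u₂ = ≡0[mod]⇒∣ (begin
    u₁ * p₂ + v₁ * u₂     ≈⟨ +-cong[mod] (*-congʳ[mod] p₂ (∣⇒≡0[mod] u₁ M∣u₁))
                                         (*-congˡ[mod] v₁ (∣⇒≡0[mod] u₂ M∣u₂)) ⟩
    + 0 * p₂ + v₁ * + 0   ≡⟨ solve (p₂ ∷ v₁ ∷ []) ⟩
    + 0                   ∎)
    where open ≡[mod]-Reasoning M

  a-· : ∀ g h → (+ M) ∣ c h → a (g · h) ≡ a g * a h [mod M ]
  a-· {M} (mat p₁ q₁ u₁ v₁) (mat p₂ q₂ u₂ v₂) M∣u₂ = begin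
    p₁ * p₂ + q₁ * u₂     ≈⟨ +-congˡ[mod] (p₁ * p₂) (*-congˡ[mod] q₁ (∣⇒≡0[mod] u₂ M∣u₂)) ⟩
    p₁ * p₂ + q₁ * + 0    ≡⟨ solve (p₁ ∷ p₂ ∷ q₁ ∷ []) ⟩
    p₁ * p₂               ∎
    where open ≡[mod]-Reasoning M

  d-· : ∀ g h → (+ M) ∣ c g → d (g · h) ≡ d g * d h [mod M ]
  d-· {M} (mat p₁ q₁ u₁ v₁) (mat p₂ q₂ u₂ v₂) M∣u₁ = begin
    u₁ * q₂ + v₁ * v₂     ≈⟨ +-cong[mod] (*-congʳ[mod] q₂ (∣⇒≡0[mod] u₁ M∣u₁)) ≡[mod]-refl ⟩
    + 0 * q₂ + v₁ * v₂    ≡⟨ solve (q₂ ∷ v₁ ∷ v₂ ∷ []) ⟩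
    v₁ * v₂               ∎
    where open ≡[mod]-Reasoning M

  a*d≡1 : ∀ g → Γ₀ M g → a g * d g ≡ + 1 [mod M ]
  a*d≡1 {M} (mat p q u v) (g∈SL₂ , M∣u) = begin
    p * v                 ≡⟨ solve (p ∷ q ∷ v ∷ []) ⟩
    p * v - q * + 0       ≈⟨ +-congˡ[mod] (p * v) (-‿cong[mod] (*-congˡ[mod] q (≡[mod]-sym (∣⇒≡0[mod] u M∣u)))) ⟩
    p * v - q * u         ≡⟨ g∈SL₂ ⟩
    + 1                   ∎
    where open ≡[mod]-Reasoning M

  Γ₀-· : ∀ g h → Γ₀ M g → Γ₀ M h → Γ₀ M (g · h)
  Γ₀-· g h (g∈SL₂ , M∣cg) (h∈SL₂ , M∣ch) = SL₂-· g h g∈SL₂ h∈SL₂ , c-· g h M∣cg M∣ch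

  Γ₀-inv : ∀ g → Γ₀ M g → Γ₀ M (inv g)
  Γ₀-inv g (g∈SL₂ , M∣cg) = SL₂-inv g g∈SL₂ , ∣-neg (c g) M∣cg

  Γ₀-subgroup : IsSubgroup (Γ₀ M)
  Γ₀-subgroup = record { ⊆SL₂ = λ _ → proj₁ ; ·-closed = Γ₀-· ; inv-closed = Γ₀-inv }

  a-neb : ∀ g h → Γ₀ M g → Γ₀ M h → a (neb g h) ≡ a h [mod M ]
  a-neb {M} g h g∈Γ₀ (_ , M∣ch) = begin
    a (g · h · inv g)     ≈⟨ a-· (g · h) (inv g) (∣-neg (c g) (proj₂ g∈Γ₀)) ⟩
    a (g · h) * d g       ≈⟨ *-congʳ[mod] (d g) (a-· g h M∣ch) ⟩
    a g * a h * d g       ≡⟨ regroup (a g) (a h) (d g) ⟩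
    a h * (a g * d g)     ≈⟨ *-congˡ[mod] (a h) (a*d≡1 g g∈Γ₀) ⟩
    a h * + 1             ≡⟨ *-identityʳ (a h) ⟩
    a h                   ∎
    where
    open ≡[mod]-Reasoning M
    regroup : ∀ x y z → x * y * z ≡ y * (x * z)
    regroup = solve-∀

  d-neb : ∀ g h → Γ₀ M g → Γ₀ M h → d (neb g h) ≡ d h [mod M ]
  d-neb {M} g h g∈Γ₀ h∈Γ₀ = begin
    d (g · h · inv g)     ≈⟨ d-· (g · h) (inv g) (proj₂ (Γ₀-· g h g∈Γ₀ h∈Γ₀)) ⟩
    d (g · h) * a g       ≈⟨ *-congʳ[mod] (a g) (d-· g h (proj₂ g∈Γ₀)) ⟩
    d g * d h * a g       ≡⟨ regroup (d g) (d h) (a g) ⟩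
    d h * (a g * d g)     ≈⟨ *-congˡ[mod] (d h) (a*d≡1 g g∈Γ₀) ⟩
    d h * + 1             ≡⟨ *-identityʳ (d h) ⟩
    d h                   ∎
    where
    open ≡[mod]-Reasoning M
    regroup : ∀ x y z → x * y * z ≡ y * (z * x)
    regroup = solve-∀

  Γ₁⇒Γ₀ : ∀ g → Γ₁ M g → Γ₀ M g
  Γ₁⇒Γ₀ _ (g∈SL₂ , _ , M∣cg , _) = g∈SL₂ , M∣cg

  a≡1 : ∀ g → Γ₁ M g → a g ≡ + 1 [mod M ]
  a≡1 _ (_ , ag≡1 , _) = mod ag≡1

  d≡1 : ∀ g → Γ₁ M g → d g ≡ + 1 [mod M ]
  d≡1 _ (_ , _ , _ , dg≡1) = mod dg≡1

  Γ₁-· : ∀ g h → Γ₁ M g → Γ₁ M h → Γ₁ M (g · h)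
  Γ₁-· {M} g h g∈Γ₁ h∈Γ₁ =
    proj₁ gh∈Γ₀ ,
    unmod (≡[mod]-trans (a-· g h (proj₂ h∈Γ₀)) (*-cong[mod] (a≡1 g g∈Γ₁) (a≡1 h h∈Γ₁))) ,
    proj₂ gh∈Γ₀ ,
    unmod (≡[mod]-trans (d-· g h (proj₂ g∈Γ₀)) (*-cong[mod] (d≡1 g g∈Γ₁) (d≡1 h h∈Γ₁)))
    where
    g∈Γ₀ : Γ₀ M g
    g∈Γ₀ = Γ₁⇒Γ₀ g g∈Γ₁
    h∈Γ₀ : Γ₀ M h
    h∈Γ₀ = Γ₁⇒Γ₀ h h∈Γ₁
    gh∈Γ₀ : Γ₀ M (g · h)
    gh∈Γ₀ = Γ₀-· g h g∈Γ₀ h∈Γ₀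

  Γ₁-inv : ∀ g → Γ₁ M g → Γ₁ M (inv g)
  Γ₁-inv g (g∈SL₂ , ag≡1 , M∣cg , dg≡1) = SL₂-inv g g∈SL₂ , dg≡1 , ∣-neg (c g) M∣cg , ag≡1

  Γ₁-subgroup : IsSubgroup (Γ₁ M)
  Γ₁-subgroup = record { ⊆SL₂ = λ _ → proj₁ ; ·-closed = Γ₁-· ; inv-closed = Γ₁-inv }

  Γ₁∩Γ₀ : ℕ → ℕ → Mat → Set
  Γ₁∩Γ₀ M R g = Γ₁ M g × Γ₀ R g

  Γ₁∩Γ₀-subgroup : ∀ M R → IsSubgroup (Γ₁∩Γ₀ M R)
  Γ₁∩Γ₀-subgroup M R = ∩-subgroup Γ₁-subgroup Γ₀-subgroup

  Γ₁-neb : ∀ g h → Γ₀ M g → Γ₁ M h → Γ₁ M (neb g h)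
  Γ₁-neb {M} g h g∈Γ₀ h∈Γ₁ =
    proj₁ ghg⁻¹∈Γ₀ ,
    unmod (≡[mod]-trans (a-neb g h g∈Γ₀ h∈Γ₀) (a≡1 h h∈Γ₁)) ,
    proj₂ ghg⁻¹∈Γ₀ ,
    unmod (≡[mod]-trans (d-neb g h g∈Γ₀ h∈Γ₀) (d≡1 h h∈Γ₁))
    where
    h∈Γ₀ : Γ₀ M h
    h∈Γ₀ = Γ₁⇒Γ₀ h h∈Γ₁
    ghg⁻¹∈Γ₀ : Γ₀ M (neb g h)
    ghg⁻¹∈Γ₀ = IsSubgroup.neb-closed Γ₀-subgroup g h g∈Γ₀ h∈Γ₀

  Γ₁-·-inv : ∀ g h → Γ₀ M g → Γ₀ M h → a g ≡ a h [mod M ] → d g ≡ d h [mod M ] → Γ₁ M (g · inv h)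
  Γ₁-·-inv {M} g h g∈Γ₀ h∈Γ₀ ag≡ah dg≡dh =
    proj₁ gh⁻¹∈Γ₀ ,
    unmod (begin
      a (g · inv h)   ≈⟨ a-· g (inv h) (∣-neg (c h) (proj₂ h∈Γ₀)) ⟩
      a g * d h       ≈⟨ *-congʳ[mod] (d h) ag≡ah ⟩
      a h * d h       ≈⟨ a*d≡1 h h∈Γ₀ ⟩
      + 1             ∎) ,
    proj₂ gh⁻¹∈Γ₀ ,
    unmod (begin
      d (g · inv h)   ≈⟨ d-· g (inv h) (proj₂ g∈Γ₀) ⟩
      d g * a h       ≈⟨ *-congʳ[mod] (a h) dg≡dh ⟩
      d h * a h       ≡⟨ *-comm (d h) (a h) ⟩
      a h * d h       ≈⟨ a*d≡1 h h∈Γ₀ ⟩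
      + 1             ∎)
    where
    open ≡[mod]-Reasoning M
    gh⁻¹∈Γ₀ : Γ₀ M (g · inv h)
    gh⁻¹∈Γ₀ = Γ₀-· g (inv h) g∈Γ₀ (Γ₀-inv h h∈Γ₀)

  Γ₀-tconj : ∀ g → (+ 2) ∣ b g → Γ₀ M g → Γ₀ M (tconj g)
  Γ₀-tconj g 2∣bg (g∈SL₂ , M∣cg) = SL₂-tconj g 2∣bg g∈SL₂ , ∣-2* (c g) M∣cg

  Γ₁-tconj : ∀ g → (+ 2) ∣ b g → Γ₁ M g → Γ₁ M (tconj g)
  Γ₁-tconj g 2∣bg (g∈SL₂ , ag≡1 , M∣cg , dg≡1) = SL₂-tconj g 2∣bg g∈SL₂ , ag≡1 , ∣-2* (c g) M∣cg , dg≡1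

  T∈Γ₁ : ∀ M → Γ₁ M T
  T∈Γ₁ M = refl , unmod (≡[mod]-refl {+ 1}) , M ℕ.∣0 , unmod (≡[mod]-refl {+ 1})

  Γ₀-∣ : K ℕ.∣ M → ∀ g → Γ₀ M g → Γ₀ K g
  Γ₀-∣ K∣M _ (g∈SL₂ , M∣cg) = g∈SL₂ , ℕ.∣-trans K∣M M∣cg

  Γ₁-∣ : K ℕ.∣ M → ∀ g → Γ₁ M g → Γ₁ K g
  Γ₁-∣ K∣M _ (g∈SL₂ , ag≡1 , M∣cg , dg≡1) =
    g∈SL₂ , ℕ.∣-trans K∣M ag≡1 , ℕ.∣-trans K∣M M∣cg , ℕ.∣-trans K∣M dg≡1

  b-neb≡[mod] : ∀ g h → Γ₁ K g → (+ K) ∣ b g → b (neb g h) ≡ b h [mod K ]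
  b-neb≡[mod] {K} g@(mat p q u v) (mat p′ q′ u′ v′) g∈Γ₁ K∣q = begin
    (p * p′ + q * u′) * (- q) + (p * q′ + q * v′) * p
      ≈⟨ +-cong[mod] (*-congˡ[mod] (p * p′ + q * u′) (-‿cong[mod] q≡0))
                     (*-cong[mod] (+-cong[mod] (*-congʳ[mod] q′ p≡1) (*-congʳ[mod] v′ q≡0)) p≡1) ⟩
    (p * p′ + q * u′) * (- + 0) + (+ 1 * q′ + + 0 * v′) * + 1
      ≡⟨ solve (p ∷ p′ ∷ q ∷ u′ ∷ q′ ∷ v′ ∷ []) ⟩
    q′ ∎
    where
    open ≡[mod]-Reasoning K
    p≡1 : p ≡ + 1 [mod K ]
    p≡1 = a≡1 g g∈Γ₁
    q≡0 : q ≡ + 0 [mod K ]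
    q≡0 = ∣⇒≡0[mod] q K∣q

  ∣b⇒∣b-neb-T : ∀ g → Γ₁ K g → (+ K) ∣ b g → (+ K) ∣ b (neb T g)
  ∣b⇒∣b-neb-T {K} g@(mat p q u v) g∈Γ₁@(_ , _ , K∣u , _) K∣q = ≡0[mod]⇒∣ (begin
    (+ 1 * p + + 1 * u) * - + 1 + (+ 1 * q + + 1 * v) * + 1
      ≈⟨ +-cong[mod] (*-congʳ[mod] (- + 1) (+-cong[mod] (*-congˡ[mod] (+ 1) p≡1) (*-congˡ[mod] (+ 1) u≡0)))
                     (*-congʳ[mod] (+ 1) (+-cong[mod] (*-congˡ[mod] (+ 1) q≡0) (*-congˡ[mod] (+ 1) v≡1))) ⟩
    (+ 1 * + 1 + + 1 * + 0) * - + 1 + (+ 1 * + 0 + + 1 * + 1) * + 1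
      ≡⟨⟩
    + 0 ∎)
    where
    open ≡[mod]-Reasoning K
    p≡1 : p ≡ + 1 [mod K ]
    p≡1 = a≡1 g g∈Γ₁
    q≡0 : q ≡ + 0 [mod K ]
    q≡0 = ∣⇒≡0[mod] q K∣q
    u≡0 : u ≡ + 0 [mod K ]
    u≡0 = ∣⇒≡0[mod] u K∣u
    v≡1 : v ≡ + 1 [mod K ]
    v≡1 = d≡1 g g∈Γ₁

  2∣b-square : ∀ g → Γ₁ 2 g → (+ 2) ∣ b (g · g)
  2∣b-square g@(mat p q u v) g∈Γ₁ = ≡0[mod]⇒∣ (begin
    p * q + q * v           ≈⟨ +-cong[mod] (*-congʳ[mod] q (a≡1 g g∈Γ₁)) (*-congˡ[mod] q (d≡1 g g∈Γ₁)) ⟩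
    + 1 * q + q * + 1       ≡⟨ solve (q ∷ []) ⟩
    q * + 2                 ≈⟨ ∣⇒≡0[mod] (q * + 2) (Signed.∣⇒∣ᵤ (Signed.divides q refl)) ⟩
    + 0                     ∎)
    where open ≡[mod]-Reasoning 2


module Equivariance where
  open import Data.Nat using (ℕ)
  open import Data.Nat.Divisibility as ℕ using (_∣?_)
  open import Data.Integer as ℤ using (+_)
  open import Data.Integer.Divisibility using (_∣_)
  open import Data.Product using (_,_; proj₁)
  open import Relation.Nullary using (¬_; yes; no)
  open import Relation.Binary.PropositionalEquality
  open ≡-Reasoning
  open Congruences
  open Matrices
  open AtkinOperator
  open Abelianisation
  open CongruenceSubgroups

  module _ {M R : ℕ} (2∣M : 2 ℕ.∣ M) (α : Mat) (α∈Γ₀[M] : Γ₀ M α) (α∈Γ₀[R] : Γ₀ R α)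
           (α∈Γ₁[2] : Γ₁ 2 α) (2∣bα : (+ 2) ∣ b α) where

    private
      H : Mat → Set
      H = Γ₁∩Γ₀ M R

      H-subgroup : IsSubgroup H
      H-subgroup = Γ₁∩Γ₀-subgroup M R

      open IsSubgroup H-subgroup
      open Commutators H-subgroup using (AbEq-·-cong; AbEq-neb-shift)

      α∈SL₂ : SL₂ α
      α∈SL₂ = proj₁ α∈Γ₀[M]

      T∈H : H T
      T∈H = T∈Γ₁ M , Γ₁⇒Γ₀ T (T∈Γ₁ R)

      H-neb-α : ∀ z → H z → H (neb α z)
      H-neb-α z (z∈Γ₁ , z∈Γ₀) =
        Γ₁-neb α z α∈Γ₀[M] z∈Γ₁ , IsSubgroup.neb-closed Γ₀-subgroup α z α∈Γ₀[R] z∈Γ₀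

      H-tconj : ∀ z → (+ 2) ∣ b z → H z → H (tconj z)
      H-tconj z 2∣bz (z∈Γ₁ , z∈Γ₀) = Γ₁-tconj z 2∣bz z∈Γ₁ , Γ₀-tconj z 2∣bz z∈Γ₀

      H-shift : ∀ g → Γ₀ M g → Γ₀ R g → (+ 2) ∣ b g → a g ≡ a α [mod M ] → d g ≡ d α [mod M ] →
                H (tconj g · inv α)
      H-shift g g∈Γ₀[M] g∈Γ₀[R] 2∣bg ag≡aα dg≡dα =
        Γ₁-·-inv (tconj g) α (Γ₀-tconj g 2∣bg g∈Γ₀[M]) α∈Γ₀[M] ag≡aα dg≡dα ,
        Γ₀-· (tconj g) (inv α) (Γ₀-tconj g 2∣bg g∈Γ₀[R]) (Γ₀-inv α α∈Γ₀[R])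

      β δ γ : Mat
      β = tconj α
      δ = neb T α
      γ = tconj δ

      βα⁻¹∈H : H (β · inv α)
      βα⁻¹∈H = H-shift α α∈Γ₀[M] α∈Γ₀[R] 2∣bα ≡[mod]-refl ≡[mod]-refl

      2∣bδ : (+ 2) ∣ b δ
      2∣bδ = ∣b⇒∣b-neb-T α α∈Γ₁[2] 2∣bα

      γα⁻¹∈H : H (γ · inv α)
      γα⁻¹∈H = H-shift δ
        (IsSubgroup.neb-closed Γ₀-subgroup T α (Γ₁⇒Γ₀ T (T∈Γ₁ M)) α∈Γ₀[M])
        (IsSubgroup.neb-closed Γ₀-subgroup T α (Γ₁⇒Γ₀ T (T∈Γ₁ R)) α∈Γ₀[R])
        2∣bδ
        (a-neb T α (Γ₁⇒Γ₀ T (T∈Γ₁ M)) α∈Γ₀[M])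
        (d-neb T α (Γ₁⇒Γ₀ T (T∈Γ₁ M)) α∈Γ₀[M])

      b-neb-α≡[2] : ∀ x → b (neb α x) ≡ b x [mod 2 ]
      b-neb-α≡[2] x = b-neb≡[mod] α x α∈Γ₁[2] 2∣bα

      odd-case : ∀ x → H x → ¬ (+ 2) ∣ b x → AbEq H (U (neb α x)) (neb α (U x))
      odd-case x x∈H@(x∈Γ₁ , _) 2∤bx =
        subst (λ y → AbEq H y (neb α (U x))) (sym U-neb-α)
          (AbEq-neb-shift α β (U x) α∈SL₂ βα⁻¹∈H (H-neb-α (U x) Ux∈H))
        where
        2∣bx² : (+ 2) ∣ b (x · x)
        2∣bx² = 2∣b-square x (Γ₁-∣ 2∣M x x∈Γ₁)

        Ux∈H : H (U x)
        Ux∈H = subst H (sym (U-odd x 2∤bx)) (H-tconj (x · x) 2∣bx² (·-closed x x x∈H x∈H))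

        2∤bαxα⁻¹ : ¬ (+ 2) ∣ b (neb α x)
        2∤bαxα⁻¹ = λ 2∣bαxα⁻¹ → 2∤bx (∣-respʳ-≡[mod] _ _ (b-neb-α≡[2] x) 2∣bαxα⁻¹)

        U-neb-α : U (neb α x) ≡ neb β (U x)
        U-neb-α = begin
          U (neb α x)                   ≡⟨ U-odd (neb α x) 2∤bαxα⁻¹ ⟩
          tconj (neb α x · neb α x)     ≡⟨ cong tconj (neb-· α α∈SL₂ x x) ⟨
          tconj (neb α (x · x))         ≡⟨ tconj-neb α (x · x) 2∣bα 2∣bx² ⟩
          neb β (tconj (x · x))         ≡⟨ cong (neb β) (U-odd x 2∤bx) ⟨
          neb β (U x)                   ∎

      even-case : ∀ x → H x → (+ 2) ∣ b x → AbEq H (U (neb α x)) (neb α (U x))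
      even-case x x∈H@(x∈Γ₁ , _) 2∣bx =
        subst₂ (AbEq H) (sym U-neb-α) (sym neb-α-U)
          (AbEq-·-cong (neb β X) (neb α X) (neb γ Y) (neb α Y) (H-neb-α X X∈H)
            (AbEq-neb-shift α β X α∈SL₂ βα⁻¹∈H (H-neb-α X X∈H))
            (AbEq-neb-shift α γ Y α∈SL₂ γα⁻¹∈H (H-neb-α Y Y∈H)))
        where
        y X Y : Mat
        y = neb T x
        X = tconj x
        Y = tconj y

        2∣by : (+ 2) ∣ b y
        2∣by = ∣b⇒∣b-neb-T x (Γ₁-∣ 2∣M x x∈Γ₁) 2∣bx

        2∣bαxα⁻¹ : (+ 2) ∣ b (neb α x)
        2∣bαxα⁻¹ = ∣-respʳ-≡[mod] _ _ (≡[mod]-sym (b-neb-α≡[2] x)) 2∣bx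

        X∈H : H X
        X∈H = H-tconj x 2∣bx x∈H

        Y∈H : H Y
        Y∈H = H-tconj y 2∣by (neb-closed T x T∈H x∈H)

        U-neb-α : U (neb α x) ≡ neb β X · neb γ Y
        U-neb-α = begin
          U (neb α x)                       ≡⟨ U-even (neb α x) 2∣bαxα⁻¹ ⟩
          tconj (neb α x · neb T (neb α x)) ≡⟨ cong (λ z → tconj (neb α x · z)) (neb-distrib-neb T refl α x) ⟩
          tconj (neb α x · neb δ y)         ≡⟨ tconj-· (neb α x) (neb δ y) 2∣bαxα⁻¹ (2∣b-neb δ y 2∣bδ 2∣by) ⟩
          tconj (neb α x) · tconj (neb δ y) ≡⟨ cong₂ _·_ (tconj-neb α x 2∣bα 2∣bx) (tconj-neb δ y 2∣bδ 2∣by) ⟩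
          neb β X · neb γ Y                 ∎

        neb-α-U : neb α (U x) ≡ neb α X · neb α Y
        neb-α-U = begin
          neb α (U x)                       ≡⟨ cong (neb α) (U-even x 2∣bx) ⟩
          neb α (tconj (x · y))             ≡⟨ cong (neb α) (tconj-· x y 2∣bx 2∣by) ⟩
          neb α (X · Y)                     ≡⟨ neb-· α α∈SL₂ X Y ⟩
          neb α X · neb α Y                 ∎

    U-neb-AbEq : ∀ x → Γ₁∩Γ₀ M R x → AbEq (Γ₁∩Γ₀ M R) (U (neb α x)) (neb α (U x))
    U-neb-AbEq x x∈H with 2 ∣? ℤ.∣ b x ∣
    ... | yes 2∣bx = even-case x x∈H 2∣bx
    ... | no 2∤bx  = odd-case x x∈H 2∤bx

open import Data.Nat using (ℕ; _≤_; _<_; _^_; _*_; suc)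
open import Data.Nat.Divisibility using (_∣_)
open import Data.Integer using (ℤ; +_)
open import Data.Product using (_×_)
open import Relation.Nullary using (¬_)

open import Data.Nat.Properties using (≤-trans; n≤1+n; m≤n⇒m≤1+n)
open import Data.Nat.Divisibility using (∣-trans; divides; m∣m*n; n∣m*n)
open import Data.Product using (_,_; proj₁; proj₂)
open import Relation.Binary.PropositionalEquality using (refl)
open OddDivisors using (^-monoʳ-∣; 2^s*odd∣)
open CongruenceSubgroups using (Γ₀-∣; Γ₁-∣)
open Equivariance using (U-neb-AbEq)

lemma3p5 : (N r s : ℕ) → 0 < N → ¬ (2 ∣ N) → 2 ≤ s → s ≤ r →
    (d : ℤ) → d ≡[ 4 ] + 1 →
    (α : Mat) → Γ₁ (4 * N) α → Γ₀ (2 ^ (suc r)) α → Γ⁰₂ α → Mat.d α ≡[ 2 ^ r ] d →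
    (x : Mat) → Φ N r s x →
    AbEq (Φ N r s) (U (neb α x)) (neb α (U x))
-- The action is given by α alone.
lemma3p5 N r s _ 2∤N 2≤s s≤r _ _ α α∈Γ₁[4N]@(_ , _ , 4N∣cα , _) α∈Γ₀[2^[1+r]] (_ , 2∣bα) _ x x∈Φ =
  U-neb-AbEq 2∣2^s*N α α∈Γ₀[2^s*N] (Γ₀-∣ (n∣m*n 2) α α∈Γ₀[2^[1+r]]) (Γ₁-∣ 2∣4N α α∈Γ₁[4N]) 2∣bα
    x x∈Φ
  where
  2∣4N : 2 ∣ 4 * N
  2∣4N = ∣-trans (divides 2 refl) (m∣m*n N)

  2∣2^s*N : 2 ∣ 2 ^ s * N
  2∣2^s*N = ∣-trans (^-monoʳ-∣ 2 (≤-trans (n≤1+n 1) 2≤s)) (m∣m*n N)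

  α∈Γ₀[2^s*N] : Γ₀ (2 ^ s * N) α
  α∈Γ₀[2^s*N] = proj₁ α∈Γ₀[2^[1+r]] ,
    2^s*odd∣ 2∤N (m≤n⇒m≤1+n s≤r) (∣-trans (n∣m*n 4) 4N∣cα) (proj₂ α∈Γ₀[2^[1+r]])
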